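{- Let $m\ge 3$, let $\mathbf d=(d_1,\dots,d_m)$ be positive integers and let $\boldsymbol\delta=(\delta_1,\dots,\delta_m)$ be positive integers such that $\gcd(\delta_i,d_i)=1$ for every $i$ and $\delta_i d_j\neq \delta_j d_i$ for all $i\neq j$. For $1\le i\le m$ define $\mathbf d_i=(d_{i,1},\dots,d_{i,m})$ by $d_{i,i}=d_i$ and $d_{i,j}=\delta_i d_j-\delta_j d_i$ for $j\neq i$. Then $$\frac{\pi(\mathbf d)}{3\sigma_1^2(\mathbf d)-\sigma_2(\mathbf d)}\sum_{i=1}^m\delta_i^{m-3}\,\frac{3\sigma_1^2(\mathbf d_i)-\sigma_2(\mathbf d_i)}{\pi(\mathbf d_i)}=1 .$$
   Context: For a vector $\mathbf e=(e_1,\dots,e_m)$ of integers, $\pi(\mathbf e)=\prod_i e_i$, $\sigma_1(\mathbf e)=\sum_i e_i$, $\sigma_2(\mathbf e)=\sum_i e_i^2$, and $\sigma_1^2(\mathbf e)$ denotes $(\sigma_1(\mathbf e))^2$. -}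

module Defs where

open import Data.Nat as ℕ using (ℕ; zero; suc)
open import Data.Fin using (Fin; zero; suc)
open import Data.Integer as ℤ using (ℤ; +_)
open import Data.Rational as ℚ using (ℚ; 0ℚ; _÷_; _/_; ≢-nonZero)
open import Data.Rational.Properties using (_≟_)
open import Relation.Nullary using (yes; no)
open import Relation.Binary.PropositionalEquality using (_≡_)

σ₁ : ∀ {m} → (Fin m → ℤ) → ℤ
σ₁ {zero} e = + 0
σ₁ {suc m} e = e zero ℤ.+ σ₁ (λ i → e (suc i))

σ₂ : ∀ {m} → (Fin m → ℤ) → ℤ
σ₂ {zero} e = + 0
σ₂ {suc m} e = e zero ℤ.* e zero ℤ.+ σ₂ (λ i → e (suc i))

π : ∀ {m} → (Fin m → ℤ) → ℤ
π {zero} e = + 1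
π {suc m} e = e zero ℤ.* π (λ i → e (suc i))

Σℚ : ∀ {m} → (Fin m → ℚ) → ℚ
Σℚ {zero} f = 0ℚ
Σℚ {suc m} f = f zero ℚ.+ Σℚ (λ i → f (suc i))

toℚ : ℤ → ℚ
toℚ z = z / 1

-- division of rationals; returns 0 when the divisor is 0 (in the theorem all
-- divisors are nonzero, so this convention never matters)
_÷₀_ : ℚ → ℚ → ℚ
p ÷₀ q with q ≟ 0ℚ
... | yes _ = 0ℚ
... | no q≢0 = _÷_ p q {{≢-nonZero q≢0}}

Q : ∀ {m} → (Fin m → ℤ) → ℤ
Q e = + 3 ℤ.* (σ₁ e ℤ.* σ₁ e) ℤ.- σ₂ e

dvec : ∀ {m} → (d δ : Fin m → ℕ) → Fin m → Fin m → ℤ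
dvec d δ i j with i Data.Fin.≟ j
... | yes _ = + d i
... | no _ = + (δ i ℕ.* d j) ℤ.- + (δ j ℕ.* d i)

-- Put c_i = d_i and t_i = δ_i / d_i; the hypothesis δ_i d_j ≠ δ_j d_i says that the t_i are distinct.
-- Off the diagonal d_{i,j} = c_i c_j (t_i − t_j), so π(d_i) = c_i^{m−1} π(d) ∏_{j≠i} (t_i − t_j), while
-- 3σ₁²(d_i) − σ₂(d_i) = c_i² P(t_i) for a quadratic P whose leading coefficient is 3σ₁²(d) − σ₂(d).
-- The i-th summand is therefore t_i^{m−3} P(t_i) / (π(d) ∏_{j≠i} (t_i − t_j)), and the sum is π(d)⁻¹ times
-- the divided difference of x^{m−3} P(x) at the m nodes t_i, which is the leading coefficient of this
-- polynomial of degree m − 1. That coefficient is nonzero because σ₂(d) ≤ σ₁²(d) and σ₁(d) > 0.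
module Submission where

open import Defs
open import Level using (0ℓ)
open import Function using (_∘_)
open import Function.Definitions using (Injective)
open import Data.Empty using (⊥-elim)
open import Data.Nat as ℕ using (ℕ; zero; suc; _≥_; _>_; _∸_; _^_; s≤s)
import Data.Nat.Properties as ℕP
import Data.Nat.Tactic.RingSolver as ℕ-Solver
open import Data.Nat.GCD using (gcd)
import Data.Nat.Coprimality as Coprime
open import Data.Fin as Fin using (Fin; zero; suc; punchIn)
open import Data.Fin.Patterns using (0F; 1F)
open import Data.Fin.Properties using (suc-injective; punchIn-injective; punchInᵢ≢i)
open import Data.Vec.Functional using (removeAt)
open import Data.Integer as ℤ using (ℤ; +_)
import Data.Integer.Properties as ℤP
open import Data.Rational as ℚ using (ℚ; 0ℚ; 1ℚ; _+_; _*_; _-_; -_; mkℚ; ≢-nonZero)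
import Data.Rational.Properties as ℚP
open import Algebra.Bundles using (CommutativeRing; CommutativeMonoid)
open import Algebra.Properties.Group ℚP.+-0-group using (x∙y⁻¹≈ε⇒x≈y; x≈y⇒x∙y⁻¹≈ε)
open import Relation.Nullary using (Dec; yes; no)
open import Relation.Nullary.Decidable using (dec⇒maybe)
open import Relation.Binary.PropositionalEquality
open import Tactic.RingSolver.Core.AlmostCommutativeRing using (AlmostCommutativeRing; fromCommutativeRing)
open import Tactic.RingSolver using (solve-∀)

open CommutativeRing ℚP.+-*-commutativeRing using (semiring; commutativeSemiring)
open import Algebra.Properties.CommutativeSemiring.Exp commutativeSemiring using (^-distrib-*) renaming (_^_ to _^ℚ_)
open import Algebra.Properties.Semiring.Sum semiring using (sum; sum-cong-≗; sum-remove; ∑-distrib-+; *-distribˡ-sum)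
open import Algebra.Properties.CommutativeMonoid.Sum ℚP.*-1-commutativeMonoid using () renaming (sum to ∏; sum-cong-≗ to ∏-cong-≗; sum-remove to ∏-remove; ∑-distrib-+ to ∏-distrib-*; sum-replicate to ∏-replicate)
import Algebra.Properties.Semiring.Sum ℕP.+-*-semiring as ℕΣ
open CommutativeMonoid ℚP.*-1-commutativeMonoid using () renaming (commutativeSemigroup to *-commutativeSemigroup)
import Algebra.Properties.CommutativeSemigroup *-commutativeSemigroup as ℚ*

ℚ-ring : AlmostCommutativeRing 0ℓ 0ℓ
ℚ-ring = fromCommutativeRing ℚP.+-*-commutativeRing (λ x → dec⇒maybe (0ℚ ℚP.≟ x))

-- A total inverse: 0ℚ ⁻¹ = 0ℚ.
infix 8 _⁻¹

_⁻¹ : ℚ → ℚ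
p ⁻¹ = 1ℚ ÷₀ p

÷₀≡*⁻¹ : ∀ p q → p ÷₀ q ≡ p * q ⁻¹
÷₀≡*⁻¹ p q with q ℚP.≟ 0ℚ
... | yes _ = sym (ℚP.*-zeroʳ p)
... | no _  = cong (p *_) (sym (ℚP.*-identityˡ _))

⁻¹-inverseʳ : ∀ {p} → p ≢ 0ℚ → p * p ⁻¹ ≡ 1ℚ
⁻¹-inverseʳ {p} p≢0 with p ℚP.≟ 0ℚ
... | yes p≡0 = ⊥-elim (p≢0 p≡0)
... | no p≢0′ = trans (cong (p *_) (ℚP.*-identityˡ _)) (ℚP.*-inverseʳ p {{≢-nonZero p≢0′}})

p*q≡0⇒q≡0 : ∀ {p q} → p ≢ 0ℚ → p * q ≡ 0ℚ → q ≡ 0ℚ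
p*q≡0⇒q≡0 {p} {q} p≢0 pq≡0 = begin
  q                ≡⟨ sym (ℚP.*-identityˡ q) ⟩
  1ℚ * q           ≡⟨ cong (_* q) (sym (⁻¹-inverseʳ p≢0)) ⟩
  p * p ⁻¹ * q     ≡⟨ ℚ*.xy∙z≈y∙xz p (p ⁻¹) q ⟩
  p ⁻¹ * (p * q)   ≡⟨ cong (p ⁻¹ *_) pq≡0 ⟩
  p ⁻¹ * 0ℚ        ≡⟨ ℚP.*-zeroʳ (p ⁻¹) ⟩
  0ℚ               ∎
  where open ≡-Reasoning

*-≢0 : ∀ {p q} → p ≢ 0ℚ → q ≢ 0ℚ → p * q ≢ 0ℚ
*-≢0 p≢0 q≢0 = q≢0 ∘ p*q≡0⇒q≡0 p≢0

^-≢0 : ∀ {p} k → p ≢ 0ℚ → p ^ℚ k ≢ 0ℚ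
^-≢0 zero    p≢0 ()
^-≢0 (suc k) p≢0 = *-≢0 p≢0 (^-≢0 k p≢0)

p≢q⇒p-q≢0 : ∀ {p q} → p ≢ q → p - q ≢ 0ℚ
p≢q⇒p-q≢0 p≢q = p≢q ∘ x∙y⁻¹≈ε⇒x≈y _ _

⁻¹-unique : ∀ {p} x → p ≢ 0ℚ → p * x ≡ 1ℚ → x ≡ p ⁻¹
⁻¹-unique {p} x p≢0 px≡1 = begin
  x                 ≡⟨ sym (ℚP.*-identityʳ x) ⟩
  x * 1ℚ            ≡⟨ cong (x *_) (sym (⁻¹-inverseʳ p≢0)) ⟩
  x * (p * p ⁻¹)    ≡⟨ ℚ*.x∙yz≈yx∙z x p (p ⁻¹) ⟩
  p * x * p ⁻¹      ≡⟨ cong (_* p ⁻¹) px≡1 ⟩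
  1ℚ * p ⁻¹         ≡⟨ ℚP.*-identityˡ (p ⁻¹) ⟩
  p ⁻¹              ∎
  where open ≡-Reasoning

⁻¹-distrib-* : ∀ p q → (p * q) ⁻¹ ≡ p ⁻¹ * q ⁻¹
⁻¹-distrib-* p q = by-cases (p ℚP.≟ 0ℚ) (q ℚP.≟ 0ℚ)
  where
  open ≡-Reasoning
  by-cases : Dec (p ≡ 0ℚ) → Dec (q ≡ 0ℚ) → (p * q) ⁻¹ ≡ p ⁻¹ * q ⁻¹
  by-cases (yes refl) _          = trans (cong _⁻¹ (ℚP.*-zeroˡ q)) (sym (ℚP.*-zeroˡ (q ⁻¹)))
  by-cases (no _)     (yes refl) = trans (cong _⁻¹ (ℚP.*-zeroʳ p)) (sym (ℚP.*-zeroʳ (p ⁻¹)))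
  by-cases (no p≢0)   (no q≢0)   = sym (⁻¹-unique (p ⁻¹ * q ⁻¹) (*-≢0 p≢0 q≢0) (begin
    p * q * (p ⁻¹ * q ⁻¹)   ≡⟨ ℚ*.interchange p q (p ⁻¹) (q ⁻¹) ⟩
    p * p ⁻¹ * (q * q ⁻¹)   ≡⟨ cong₂ _*_ (⁻¹-inverseʳ p≢0) (⁻¹-inverseʳ q≢0) ⟩
    1ℚ                      ∎))

*-⁻¹-cancelˡ : ∀ {a} x y → a ≢ 0ℚ → a * x * (a * y) ⁻¹ ≡ x * y ⁻¹
*-⁻¹-cancelˡ {a} x y a≢0 = begin
  a * x * (a * y) ⁻¹          ≡⟨ cong (a * x *_) (⁻¹-distrib-* a y) ⟩
  a * x * (a ⁻¹ * y ⁻¹)       ≡⟨ ℚ*.interchange a x (a ⁻¹) (y ⁻¹) ⟩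
  a * a ⁻¹ * (x * y ⁻¹)       ≡⟨ cong (_* (x * y ⁻¹)) (⁻¹-inverseʳ a≢0) ⟩
  1ℚ * (x * y ⁻¹)             ≡⟨ ℚP.*-identityˡ _ ⟩
  x * y ⁻¹                    ∎
  where open ≡-Reasoning

-- toℚ z is the normalised fraction z/1, on which the operations of ℚ compute definitionally.
mkℚ₁ : ℤ → ℚ
mkℚ₁ z = mkℚ z 0 (Coprime.sym (Coprime.1-coprimeTo _))

toℚ≡mkℚ₁ : ∀ z → toℚ z ≡ mkℚ₁ z
toℚ≡mkℚ₁ z = ℚP.↥p/↧p≡p (mkℚ₁ z)

toℚ-injective : Injective _≡_ _≡_ toℚ
toℚ-injective {a} {b} eq = cong ℚ.↥_ (trans (sym (toℚ≡mkℚ₁ a)) (trans eq (toℚ≡mkℚ₁ b)))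

toℚ-+ : ∀ a b → toℚ (a ℤ.+ b) ≡ toℚ a + toℚ b
toℚ-+ a b = begin
  toℚ (a ℤ.+ b)                      ≡⟨ cong toℚ (sym (cong₂ ℤ._+_ (ℤP.*-identityʳ a) (ℤP.*-identityʳ b))) ⟩
  toℚ (a ℤ.* + 1 ℤ.+ b ℤ.* + 1)      ≡⟨ sym (cong₂ _+_ (toℚ≡mkℚ₁ a) (toℚ≡mkℚ₁ b)) ⟩
  toℚ a + toℚ b                      ∎
  where open ≡-Reasoning

toℚ-* : ∀ a b → toℚ (a ℤ.* b) ≡ toℚ a * toℚ b
toℚ-* a b = sym (cong₂ _*_ (toℚ≡mkℚ₁ a) (toℚ≡mkℚ₁ b))

toℚ-neg : ∀ a → toℚ (ℤ.- a) ≡ - toℚ a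
toℚ-neg a = trans (toℚ≡mkℚ₁ (ℤ.- a)) (trans (mkℚ-neg a) (cong -_ (sym (toℚ≡mkℚ₁ a))))
  where
  mkℚ-neg : ∀ a → mkℚ₁ (ℤ.- a) ≡ - mkℚ₁ a
  mkℚ-neg (+ zero)     = refl
  mkℚ-neg ℤ.+[1+ n ]   = refl
  mkℚ-neg ℤ.-[1+ n ]   = refl

toℚ-- : ∀ a b → toℚ (a ℤ.- b) ≡ toℚ a - toℚ b
toℚ-- a b = trans (toℚ-+ a (ℤ.- b)) (cong (_+_ (toℚ a)) (toℚ-neg b))

fromℕ : ℕ → ℚ
fromℕ n = toℚ (+ n)

fromℕ-* : ∀ a b → fromℕ (a ℕ.* b) ≡ fromℕ a * fromℕ b
fromℕ-* a b = trans (cong toℚ (ℤP.pos-* a b)) (toℚ-* (+ a) (+ b))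

fromℕ-^ : ∀ a k → fromℕ (a ^ k) ≡ fromℕ a ^ℚ k
fromℕ-^ a zero    = refl
fromℕ-^ a (suc k) = trans (fromℕ-* a (a ^ k)) (cong (fromℕ a *_) (fromℕ-^ a k))

Σℚ≡sum : ∀ {m} (f : Fin m → ℚ) → Σℚ f ≡ sum f
Σℚ≡sum {zero}  f = refl
Σℚ≡sum {suc m} f = cong (_+_ (f zero)) (Σℚ≡sum (f ∘ suc))

toℚ-σ₁ : ∀ {m} (e : Fin m → ℤ) → toℚ (σ₁ e) ≡ sum (toℚ ∘ e)
toℚ-σ₁ {zero}  e = refl
toℚ-σ₁ {suc m} e = trans (toℚ-+ (e zero) _) (cong (_+_ (toℚ (e zero))) (toℚ-σ₁ (e ∘ suc)))

toℚ-σ₂ : ∀ {m} (e : Fin m → ℤ) → toℚ (σ₂ e) ≡ sum (λ i → toℚ (e i) * toℚ (e i))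
toℚ-σ₂ {zero}  e = refl
toℚ-σ₂ {suc m} e = trans (toℚ-+ (e zero ℤ.* e zero) _)
  (cong₂ _+_ (toℚ-* (e zero) (e zero)) (toℚ-σ₂ (e ∘ suc)))

toℚ-π : ∀ {m} (e : Fin m → ℤ) → toℚ (π e) ≡ ∏ (toℚ ∘ e)
toℚ-π {zero}  e = refl
toℚ-π {suc m} e = trans (toℚ-* (e zero) _) (cong (toℚ (e zero) *_) (toℚ-π (e ∘ suc)))

three : ℚ
three = fromℕ 3

Qℚ : ∀ {m} → (Fin m → ℚ) → ℚ
Qℚ v = three * (sum v * sum v) - sum (λ i → v i * v i)

toℚ-Q : ∀ {m} (e : Fin m → ℤ) → toℚ (Q e) ≡ Qℚ (toℚ ∘ e)
toℚ-Q e = begin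
  toℚ (Q e)                                               ≡⟨ toℚ-- (+ 3 ℤ.* (σ₁ e ℤ.* σ₁ e)) (σ₂ e) ⟩
  toℚ (+ 3 ℤ.* (σ₁ e ℤ.* σ₁ e)) - toℚ (σ₂ e)              ≡⟨ cong (_- toℚ (σ₂ e)) (trans (toℚ-* (+ 3) (σ₁ e ℤ.* σ₁ e)) (cong (three *_) (toℚ-* (σ₁ e) (σ₁ e)))) ⟩
  three * (toℚ (σ₁ e) * toℚ (σ₁ e)) - toℚ (σ₂ e)          ≡⟨ cong₂ (λ x y → three * (x * x) - y) (toℚ-σ₁ e) (toℚ-σ₂ e) ⟩
  Qℚ (toℚ ∘ e)                                            ∎
  where open ≡-Reasoning

sum-linear : ∀ {m} a b (f g : Fin m → ℚ) → sum (λ j → a * f j + b * g j) ≡ a * sum f + b * sum g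
sum-linear a b f g = trans (∑-distrib-+ (λ j → a * f j) (λ j → b * g j))
  (sym (cong₂ _+_ (*-distribˡ-sum a f) (*-distribˡ-sum b g)))

sum-linear₃ : ∀ {m} a b e (f g h : Fin m → ℚ) →
              sum (λ j → a * f j + b * g j + e * h j) ≡ a * sum f + b * sum g + e * sum h
sum-linear₃ a b e f g h = trans (∑-distrib-+ (λ j → a * f j + b * g j) (λ j → e * h j))
  (cong₂ _+_ (sum-linear a b f g) (sym (*-distribˡ-sum e h)))

∏-≢0 : ∀ {m} (f : Fin m → ℚ) → (∀ i → f i ≢ 0ℚ) → ∏ f ≢ 0ℚ
∏-≢0 {zero}  f f≢0 ()
∏-≢0 {suc m} f f≢0 = *-≢0 (f≢0 zero) (∏-≢0 (f ∘ suc) (f≢0 ∘ suc))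

sum-agreeExcept : ∀ {n} {f h : Fin (suc n) → ℚ} i → (∀ j → j ≢ i → f j ≡ h j) → h i ≡ 0ℚ →
                  sum f ≡ f i + sum h
sum-agreeExcept {f = f} {h} i f≡h hᵢ≡0 = begin
  sum f                          ≡⟨ sum-remove f ⟩
  f i + sum (removeAt f i)       ≡⟨ cong (_+_ (f i)) (sum-cong-≗ (λ j → f≡h (punchIn i j) (punchInᵢ≢i i j))) ⟩
  f i + sum (removeAt h i)       ≡⟨ cong (_+_ (f i)) (sym (ℚP.+-identityˡ _)) ⟩
  f i + (0ℚ + sum (removeAt h i)) ≡⟨ cong (λ x → f i + (x + sum (removeAt h i))) (sym hᵢ≡0) ⟩
  f i + (h i + sum (removeAt h i)) ≡⟨ cong (_+_ (f i)) (sym (sum-remove h)) ⟩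
  f i + sum h                    ∎
  where open ≡-Reasoning

ω′ : ∀ {n} → (Fin (suc n) → ℚ) → Fin (suc n) → ℚ
ω′ t i = ∏ (removeAt (λ j → t i - t j) i)

divDiff : ∀ {n} → (Fin (suc n) → ℚ) → (ℚ → ℚ) → ℚ
divDiff t f = sum (λ i → f (t i) * ω′ t i ⁻¹)

divDiff-cong : ∀ {n} (t : Fin (suc n) → ℚ) {f g : ℚ → ℚ} → (∀ x → f x ≡ g x) → divDiff t f ≡ divDiff t g
divDiff-cong t f≗g = sum-cong-≗ (λ i → cong (_* ω′ t i ⁻¹) (f≗g (t i)))

divDiff-+ : ∀ {n} (t : Fin (suc n) → ℚ) (f g : ℚ → ℚ) →
            divDiff t (λ x → f x + g x) ≡ divDiff t f + divDiff t g
divDiff-+ t f g = trans (sum-cong-≗ (λ i → ℚP.*-distribʳ-+ (ω′ t i ⁻¹) (f (t i)) (g (t i))))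
  (∑-distrib-+ (λ i → f (t i) * ω′ t i ⁻¹) (λ i → g (t i) * ω′ t i ⁻¹))

divDiff-*ˡ : ∀ {n} (t : Fin (suc n) → ℚ) a (f : ℚ → ℚ) → divDiff t (λ x → a * f x) ≡ a * divDiff t f
divDiff-*ˡ t a f = trans (sum-cong-≗ (λ i → ℚP.*-assoc a (f (t i)) (ω′ t i ⁻¹)))
  (sym (*-distribˡ-sum a (λ i → f (t i) * ω′ t i ⁻¹)))

[a-a]*x*y≡0 : ∀ a x y → (a - a) * x * y ≡ 0ℚ
[a-a]*x*y≡0 = solve-∀ ℚ-ring

-- ω′ t (suc k) reduces to (t (suc k) - t 0F) * ω′ (t ∘ suc) k, which cancels the factor x - t 0F.
divDiff-drop₀ : ∀ {n} (t : Fin (suc (suc n)) → ℚ) → Injective _≡_ _≡_ t → (h : ℚ → ℚ) →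
                divDiff t (λ x → (x - t 0F) * h x) ≡ divDiff (t ∘ suc) h
divDiff-drop₀ t inj h = begin
  divDiff t (λ x → (x - a) * h x)
    ≡⟨⟩
  (a - a) * h a * ω′ t 0F ⁻¹ + sum (λ k → (t (suc k) - a) * h (t (suc k)) * ((t (suc k) - a) * ω′ (t ∘ suc) k) ⁻¹)
    ≡⟨ cong₂ _+_ ([a-a]*x*y≡0 a (h a) (ω′ t 0F ⁻¹)) (sum-cong-≗ λ k → *-⁻¹-cancelˡ (h (t (suc k))) (ω′ (t ∘ suc) k) (p≢q⇒p-q≢0 ((λ ()) ∘ inj {suc k} {0F}))) ⟩
  0ℚ + divDiff (t ∘ suc) h
    ≡⟨ ℚP.+-identityˡ _ ⟩
  divDiff (t ∘ suc) h ∎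
  where
  open ≡-Reasoning
  a = t 0F

ω′-drop₁ : ∀ {n} (t : Fin (suc (suc n)) → ℚ) (k : Fin n) →
           ω′ t (suc (suc k)) ≡ (t (suc (suc k)) - t 1F) * ω′ (removeAt t 1F) (suc k)
ω′-drop₁ {suc n} t k = ℚ*.x∙yz≈y∙xz (t (suc (suc k)) - t 0F) (t (suc (suc k)) - t 1F) _

divDiff-drop₁ : ∀ {n} (t : Fin (suc (suc n)) → ℚ) → Injective _≡_ _≡_ t → (h : ℚ → ℚ) →
                divDiff t (λ x → (x - t 1F) * h x) ≡ divDiff (removeAt t 1F) h
divDiff-drop₁ t inj h = begin
  divDiff t (λ x → (x - b) * h x)
    ≡⟨⟩
  (a - b) * h a * ((a - b) * ω′ t′ 0F) ⁻¹
    + ((b - b) * h b * ω′ t 1F ⁻¹ + sum (λ k → (t′ (suc k) - b) * h (t′ (suc k)) * ω′ t (suc (suc k)) ⁻¹))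
    ≡⟨ cong₂ _+_ (*-⁻¹-cancelˡ (h a) (ω′ t′ 0F) (p≢q⇒p-q≢0 ((λ ()) ∘ inj)))
                 (cong₂ _+_ ([a-a]*x*y≡0 b (h b) (ω′ t 1F ⁻¹)) (sum-cong-≗ cancel-b)) ⟩
  h a * ω′ t′ 0F ⁻¹ + (0ℚ + sum (λ k → h (t′ (suc k)) * ω′ t′ (suc k) ⁻¹))
    ≡⟨ cong (_+_ (h a * ω′ t′ 0F ⁻¹)) (ℚP.+-identityˡ _) ⟩
  divDiff t′ h ∎
  where
  open ≡-Reasoning
  a = t 0F
  b = t 1F
  t′ = removeAt t 1F
  cancel-b : ∀ k → (t′ (suc k) - b) * h (t′ (suc k)) * ω′ t (suc (suc k)) ⁻¹ ≡ h (t′ (suc k)) * ω′ t′ (suc k) ⁻¹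
  cancel-b k = trans (cong (λ w → (t′ (suc k) - b) * h (t′ (suc k)) * w ⁻¹) (ω′-drop₁ t k))
                     (*-⁻¹-cancelˡ (h (t′ (suc k))) (ω′ t′ (suc k)) (p≢q⇒p-q≢0 ((λ ()) ∘ inj)))

divDiff-recurrence : ∀ {n} (t : Fin (suc (suc n)) → ℚ) → Injective _≡_ _≡_ t → (h : ℚ → ℚ) →
                     (t 1F - t 0F) * divDiff t h ≡ divDiff (t ∘ suc) h - divDiff (removeAt t 1F) h
divDiff-recurrence t inj h = begin
  (b - a) * divDiff t h                              ≡⟨ sym (divDiff-*ˡ t (b - a) h) ⟩
  divDiff t (λ x → (b - a) * h x)                    ≡⟨ divDiff-cong t (λ x → split x a b (h x)) ⟩
  divDiff t (λ x → hₐ x + - 1ℚ * h_b x)              ≡⟨ divDiff-+ t hₐ (λ x → - 1ℚ * h_b x) ⟩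
  divDiff t hₐ + divDiff t (λ x → - 1ℚ * h_b x)      ≡⟨ cong (_+_ (divDiff t hₐ)) (divDiff-*ˡ t (- 1ℚ) h_b) ⟩
  divDiff t hₐ + - 1ℚ * divDiff t h_b                ≡⟨ cong₂ (λ u v → u + - 1ℚ * v) (divDiff-drop₀ t inj h) (divDiff-drop₁ t inj h) ⟩
  divDiff (t ∘ suc) h + - 1ℚ * divDiff t′ h          ≡⟨ u+-1*v≡u-v (divDiff (t ∘ suc) h) (divDiff t′ h) ⟩
  divDiff (t ∘ suc) h - divDiff t′ h                 ∎
  where
  open ≡-Reasoning
  a = t 0F
  b = t 1F
  t′ = removeAt t 1F
  hₐ h_b : ℚ → ℚ
  hₐ x = (x - a) * h x
  h_b x = (x - b) * h x
  split : ∀ x a b y → (b - a) * y ≡ (x - a) * y + - 1ℚ * ((x - b) * y)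
  split = solve-∀ ℚ-ring
  u+-1*v≡u-v : ∀ u v → u + - 1ℚ * v ≡ u - v
  u+-1*v≡u-v = solve-∀ ℚ-ring

divDiff-vanishes : ∀ {n} (t : Fin (suc (suc n)) → ℚ) → Injective _≡_ _≡_ t → (h : ℚ → ℚ) →
                   divDiff (t ∘ suc) h ≡ divDiff (removeAt t 1F) h → divDiff t h ≡ 0ℚ
divDiff-vanishes t inj h same = p*q≡0⇒q≡0 (p≢q⇒p-q≢0 ((λ ()) ∘ inj))
  (trans (divDiff-recurrence t inj h) (x≈y⇒x∙y⁻¹≈ε same))

divDiff-const : ∀ n (t : Fin (suc (suc n)) → ℚ) → Injective _≡_ _≡_ t → divDiff t (λ _ → 1ℚ) ≡ 0ℚ
divDiff-const zero    t inj = divDiff-vanishes t inj (λ _ → 1ℚ) refl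
divDiff-const (suc n) t inj = divDiff-vanishes t inj (λ _ → 1ℚ)
  (trans (divDiff-const n (t ∘ suc) (suc-injective ∘ inj))
         (sym (divDiff-const n (removeAt t 1F) (punchIn-injective 1F _ _ ∘ inj))))

divDiff-^-suc : ∀ {n} (t : Fin (suc (suc n)) → ℚ) → Injective _≡_ _≡_ t → ∀ k →
                divDiff t (_^ℚ suc k) ≡ divDiff (t ∘ suc) (_^ℚ k) + t 0F * divDiff t (_^ℚ k)
divDiff-^-suc t inj k = begin
  divDiff t (_^ℚ suc k)
    ≡⟨ divDiff-cong t (λ x → split x (t 0F) (x ^ℚ k)) ⟩
  divDiff t (λ x → (x - t 0F) * x ^ℚ k + t 0F * x ^ℚ k)
    ≡⟨ divDiff-+ t (λ x → (x - t 0F) * x ^ℚ k) (λ x → t 0F * x ^ℚ k) ⟩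
  divDiff t (λ x → (x - t 0F) * x ^ℚ k) + divDiff t (λ x → t 0F * x ^ℚ k)
    ≡⟨ cong₂ _+_ (divDiff-drop₀ t inj (_^ℚ k)) (divDiff-*ˡ t (t 0F) (_^ℚ k)) ⟩
  divDiff (t ∘ suc) (_^ℚ k) + t 0F * divDiff t (_^ℚ k) ∎
  where
  open ≡-Reasoning
  split : ∀ x a p → x * p ≡ (x - a) * p + a * p
  split = solve-∀ ℚ-ring

divDiff-^-< : ∀ n (t : Fin (suc n) → ℚ) → Injective _≡_ _≡_ t → ∀ {k} → k ℕ.< n → divDiff t (_^ℚ k) ≡ 0ℚ
divDiff-^-< (suc n) t inj {zero}  _          = divDiff-const n t inj
divDiff-^-< (suc n) t inj {suc k} (s≤s k<n) = begin
  divDiff t (_^ℚ suc k)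
    ≡⟨ divDiff-^-suc t inj k ⟩
  divDiff (t ∘ suc) (_^ℚ k) + t 0F * divDiff t (_^ℚ k)
    ≡⟨ cong₂ (λ u v → u + t 0F * v) (divDiff-^-< n (t ∘ suc) (suc-injective ∘ inj) k<n)
                                      (divDiff-^-< (suc n) t inj (ℕP.m<n⇒m<1+n k<n)) ⟩
  0ℚ + t 0F * 0ℚ
    ≡⟨ trans (ℚP.+-identityˡ _) (ℚP.*-zeroʳ (t 0F)) ⟩
  0ℚ ∎
  where open ≡-Reasoning

divDiff-^-≡ : ∀ n (t : Fin (suc n) → ℚ) → Injective _≡_ _≡_ t → divDiff t (_^ℚ n) ≡ 1ℚ
divDiff-^-≡ zero    t inj = refl
divDiff-^-≡ (suc n) t inj = begin
  divDiff t (_^ℚ suc n)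
    ≡⟨ divDiff-^-suc t inj n ⟩
  divDiff (t ∘ suc) (_^ℚ n) + t 0F * divDiff t (_^ℚ n)
    ≡⟨ cong₂ (λ u v → u + t 0F * v) (divDiff-^-≡ n (t ∘ suc) (suc-injective ∘ inj))
                                      (divDiff-^-< (suc n) t inj (ℕP.n<1+n n)) ⟩
  1ℚ + t 0F * 0ℚ
    ≡⟨ cong (_+_ 1ℚ) (ℚP.*-zeroʳ (t 0F)) ⟩
  1ℚ ∎
  where open ≡-Reasoning

divDiff-^-quadratic : ∀ k (t : Fin (suc (suc (suc k))) → ℚ) → Injective _≡_ _≡_ t → ∀ a b e →
                      divDiff t (λ x → x ^ℚ k * (a * (x * x) + b * x + e)) ≡ a
divDiff-^-quadratic k t inj a b e = begin
  divDiff t (λ x → x ^ℚ k * (a * (x * x) + b * x + e))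
    ≡⟨ divDiff-cong t (λ x → expand a b e x (x ^ℚ k)) ⟩
  divDiff t (λ x → a * x ^ℚ (2 ℕ.+ k) + b * x ^ℚ (1 ℕ.+ k) + e * x ^ℚ k)
    ≡⟨ divDiff-+ t (λ x → a * x ^ℚ (2 ℕ.+ k) + b * x ^ℚ (1 ℕ.+ k)) (λ x → e * x ^ℚ k) ⟩
  divDiff t (λ x → a * x ^ℚ (2 ℕ.+ k) + b * x ^ℚ (1 ℕ.+ k)) + divDiff t (λ x → e * x ^ℚ k)
    ≡⟨ cong (_+ divDiff t (λ x → e * x ^ℚ k)) (divDiff-+ t (λ x → a * x ^ℚ (2 ℕ.+ k)) (λ x → b * x ^ℚ (1 ℕ.+ k))) ⟩
  divDiff t (λ x → a * x ^ℚ (2 ℕ.+ k)) + divDiff t (λ x → b * x ^ℚ (1 ℕ.+ k)) + divDiff t (λ x → e * x ^ℚ k)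
    ≡⟨ cong₂ _+_ (cong₂ _+_ (divDiff-*ˡ t a (_^ℚ (2 ℕ.+ k))) (divDiff-*ˡ t b (_^ℚ (1 ℕ.+ k)))) (divDiff-*ˡ t e (_^ℚ k)) ⟩
  a * divDiff t (_^ℚ (2 ℕ.+ k)) + b * divDiff t (_^ℚ (1 ℕ.+ k)) + e * divDiff t (_^ℚ k)
    ≡⟨ cong₂ _+_ (cong₂ (λ u v → a * u + b * v) (divDiff-^-≡ (2 ℕ.+ k) t inj) (divDiff-^-< (2 ℕ.+ k) t inj (ℕP.n<1+n (suc k))))
                 (cong (e *_) (divDiff-^-< (2 ℕ.+ k) t inj (ℕP.m<n⇒m<1+n (ℕP.n<1+n k)))) ⟩
  a * 1ℚ + b * 0ℚ + e * 0ℚ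
    ≡⟨ collapse a b e ⟩
  a ∎
  where
  open ≡-Reasoning
  expand : ∀ a b e x p → p * (a * (x * x) + b * x + e) ≡ a * (x * (x * p)) + b * (x * p) + e * p
  expand = solve-∀ ℚ-ring
  collapse : ∀ a b e → a * 1ℚ + b * 0ℚ + e * 0ℚ ≡ a
  collapse = solve-∀ ℚ-ring

σ₁-pos : ∀ {m} (f : Fin m → ℕ) → σ₁ (λ i → + f i) ≡ + ℕΣ.sum f
σ₁-pos {zero}  f = refl
σ₁-pos {suc m} f = trans (cong (ℤ._+_ (+ f zero)) (σ₁-pos (f ∘ suc))) (sym (ℤP.pos-+ (f zero) _))

σ₂-pos : ∀ {m} (f : Fin m → ℕ) → σ₂ (λ i → + f i) ≡ + ℕΣ.sum (λ i → f i ℕ.* f i)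
σ₂-pos {zero}  f = refl
σ₂-pos {suc m} f = trans (cong₂ ℤ._+_ (sym (ℤP.pos-* (f zero) (f zero))) (σ₂-pos (f ∘ suc)))
                       (sym (ℤP.pos-+ (f zero ℕ.* f zero) _))

sum-squares≤square-sum : ∀ {m} (f : Fin m → ℕ) → ℕΣ.sum (λ i → f i ℕ.* f i) ℕ.≤ ℕΣ.sum f ℕ.* ℕΣ.sum f
sum-squares≤square-sum {zero}  f = ℕ.z≤n
sum-squares≤square-sum {suc m} f = begin
  a ℕ.* a ℕ.+ ℕΣ.sum (λ i → f (suc i) ℕ.* f (suc i))
    ≤⟨ ℕP.+-monoʳ-≤ (a ℕ.* a) (sum-squares≤square-sum (f ∘ suc)) ⟩
  a ℕ.* a ℕ.+ s ℕ.* s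
    ≤⟨ ℕP.+-monoʳ-≤ (a ℕ.* a) (ℕP.m≤n+m (s ℕ.* s) (2 ℕ.* (a ℕ.* s))) ⟩
  a ℕ.* a ℕ.+ (2 ℕ.* (a ℕ.* s) ℕ.+ s ℕ.* s)
    ≡⟨ square-of-sum a s ⟩
  (a ℕ.+ s) ℕ.* (a ℕ.+ s)
    ∎
  where
  open ℕP.≤-Reasoning
  a = f zero
  s = ℕΣ.sum (f ∘ suc)
  square-of-sum : ∀ a s → a ℕ.* a ℕ.+ (2 ℕ.* (a ℕ.* s) ℕ.+ s ℕ.* s) ≡ (a ℕ.+ s) ℕ.* (a ℕ.+ s)
  square-of-sum = ℕ-Solver.solve-∀

Q-pos : ∀ {m} (f : Fin m → ℕ) →
        Q (λ i → + f i) ≡ + (3 ℕ.* (ℕΣ.sum f ℕ.* ℕΣ.sum f)) ℤ.- + ℕΣ.sum (λ i → f i ℕ.* f i)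
Q-pos f = begin
  Q (λ i → + f i)
    ≡⟨ cong₂ (λ x y → + 3 ℤ.* (x ℤ.* x) ℤ.- y) (σ₁-pos f) (σ₂-pos f) ⟩
  + 3 ℤ.* (+ S ℤ.* + S) ℤ.- + S₂
    ≡⟨ cong (ℤ._- + S₂) (sym (trans (ℤP.pos-* 3 (S ℕ.* S)) (cong (ℤ._*_ (+ 3)) (ℤP.pos-* S S)))) ⟩
  + (3 ℕ.* (S ℕ.* S)) ℤ.- + S₂
    ∎
  where
  open ≡-Reasoning
  S = ℕΣ.sum f
  S₂ = ℕΣ.sum (λ i → f i ℕ.* f i)

Q-pos≢0 : ∀ {m} (f : Fin m → ℕ) → 0 ℕ.< ℕΣ.sum f → Q (λ i → + f i) ≢ + 0
Q-pos≢0 f 0<S Q≡0 = ℕP.<⇒≱ S²<3S² (begin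
  3 ℕ.* (S ℕ.* S)   ≡⟨ ℤP.+-injective (ℤP.i-j≡0⇒i≡j _ _ (trans (sym (Q-pos f)) Q≡0)) ⟩
  S₂                ≤⟨ sum-squares≤square-sum f ⟩
  S ℕ.* S           ∎)
  where
  open ℕP.≤-Reasoning
  S = ℕΣ.sum f
  S₂ = ℕΣ.sum (λ i → f i ℕ.* f i)
  S²<3S² : S ℕ.* S ℕ.< 3 ℕ.* (S ℕ.* S)
  S²<3S² = ℕP.m<m+n (S ℕ.* S) (ℕP.*-mono-< {0} {2} ℕ.z<s (ℕP.*-mono-< 0<S 0<S))

module DVecProperties {n : ℕ} (d δ : Fin (suc n) → ℕ) (d>0 : ∀ i → d i > 0) where

  c s t : Fin (suc n) → ℚ
  c = fromℕ ∘ d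
  s = fromℕ ∘ δ
  t i = s i * c i ⁻¹

  c≢0 : ∀ i → c i ≢ 0ℚ
  c≢0 i cᵢ≡0 = ℕP.>⇒≢ (d>0 i) (ℤP.+-injective (toℚ-injective cᵢ≡0))

  s≡t*c : ∀ i → s i ≡ t i * c i
  s≡t*c i = sym (begin
    s i * c i ⁻¹ * c i     ≡⟨ ℚ*.xy∙z≈x∙zy (s i) (c i ⁻¹) (c i) ⟩
    s i * (c i * c i ⁻¹)   ≡⟨ cong (s i *_) (⁻¹-inverseʳ (c≢0 i)) ⟩
    s i * 1ℚ               ≡⟨ ℚP.*-identityʳ (s i) ⟩
    s i                    ∎)
    where open ≡-Reasoning

  t-injective : (∀ i j → i ≢ j → δ i ℕ.* d j ≢ δ j ℕ.* d i) → Injective _≡_ _≡_ t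
  t-injective cross≢ {i} {j} tᵢ≡tⱼ with i Fin.≟ j
  ... | yes i≡j = i≡j
  ... | no  i≢j = ⊥-elim (cross≢ i j i≢j (ℤP.+-injective (toℚ-injective (begin
    fromℕ (δ i ℕ.* d j)   ≡⟨ fromℕ-* (δ i) (d j) ⟩
    s i * c j             ≡⟨ cong (_* c j) (s≡t*c i) ⟩
    t i * c i * c j       ≡⟨ cong (λ x → x * c i * c j) tᵢ≡tⱼ ⟩
    t j * c i * c j       ≡⟨ ℚ*.xy∙z≈xz∙y (t j) (c i) (c j) ⟩
    t j * c j * c i       ≡⟨ cong (_* c i) (sym (s≡t*c j)) ⟩
    s j * c i             ≡⟨ sym (fromℕ-* (δ j) (d i)) ⟩
    fromℕ (δ j ℕ.* d i)   ∎))))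
    where open ≡-Reasoning

  cross : Fin (suc n) → Fin (suc n) → ℚ
  cross i j = s i * c j - s j * c i

  dvec-diag : ∀ i → toℚ (dvec d δ i i) ≡ c i
  dvec-diag i with i Fin.≟ i
  ... | yes _   = refl
  ... | no  i≢i = ⊥-elim (i≢i refl)

  dvec-offDiag : ∀ i j → j ≢ i → toℚ (dvec d δ i j) ≡ cross i j
  dvec-offDiag i j j≢i with i Fin.≟ j
  ... | yes i≡j = ⊥-elim (j≢i (sym i≡j))
  ... | no  _   = trans (toℚ-- (+ (δ i ℕ.* d j)) (+ (δ j ℕ.* d i)))
                        (cong₂ _-_ (fromℕ-* (δ i) (d j)) (fromℕ-* (δ j) (d i)))

  cross-diag : ∀ i → cross i i ≡ 0ℚ
  cross-diag i = ℚP.+-inverseʳ (s i * c i)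

  cross≡ : ∀ i j → cross i j ≡ c i * (c j * (t i - t j))
  cross≡ i j = trans (cong₂ (λ x y → x * c j - y * c i) (s≡t*c i) (s≡t*c j)) (factor (t i) (c i) (t j) (c j))
    where
    factor : ∀ a x b y → a * x * y - b * y * x ≡ x * (y * (a - b))
    factor = solve-∀ ℚ-ring

  π-dvec : ∀ i → toℚ (π (dvec d δ i)) ≡ c i ^ℚ n * (∏ c * ω′ t i)
  π-dvec i = begin
    toℚ (π (dvec d δ i))
      ≡⟨ toℚ-π (dvec d δ i) ⟩
    ∏ e
      ≡⟨ ∏-remove e ⟩
    e i * ∏ (removeAt e i)
      ≡⟨ cong₂ _*_ (dvec-diag i) (∏-cong-≗ (λ j → trans (dvec-offDiag i _ (punchInᵢ≢i i j)) (cross≡ i _))) ⟩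
    c i * ∏ (λ j → c i * (removeAt c i j * removeAt (λ j → t i - t j) i j))
      ≡⟨ cong (c i *_) (trans (∏-distrib-* (λ _ → c i) (λ j → removeAt c i j * removeAt (λ j → t i - t j) i j))
                              (cong₂ _*_ (∏-replicate n) (∏-distrib-* (removeAt c i) (removeAt (λ j → t i - t j) i)))) ⟩
    c i * (c i ^ℚ n * (∏ (removeAt c i) * ω′ t i))
      ≡⟨ regroup (c i) (c i ^ℚ n) (∏ (removeAt c i)) (ω′ t i) ⟩
    c i ^ℚ n * (c i * ∏ (removeAt c i) * ω′ t i)
      ≡⟨ cong (λ x → c i ^ℚ n * (x * ω′ t i)) (sym (∏-remove c)) ⟩
    c i ^ℚ n * (∏ c * ω′ t i)
      ∎
    where
    open ≡-Reasoning
    e : Fin (suc n) → ℚ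
    e = toℚ ∘ dvec d δ i
    regroup : ∀ a p q w → a * (p * (q * w)) ≡ p * (a * q * w)
    regroup = solve-∀ ℚ-ring

  S T S₂ R T₂ : ℚ
  S = sum c
  T = sum s
  S₂ = sum (λ j → c j * c j)
  R = sum (λ j → c j * s j)
  T₂ = sum (λ j → s j * s j)

  B C : ℚ
  B = three * ((1ℚ - T) * S + (1ℚ - T) * S) + (R + R)
  C = three * ((1ℚ - T) * (1ℚ - T)) - (1ℚ + T₂)

  -- P x = 3 (1 + x S − T)² − (1 + x² S₂ − 2 x R + T₂), expanded in powers of x.
  P : ℚ → ℚ
  P x = Qℚ c * (x * x) + B * x + C

  σ₁-row : ∀ i → sum (toℚ ∘ dvec d δ i) ≡ c i + (s i * S + (- c i) * T)
  σ₁-row i = begin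
    sum (toℚ ∘ dvec d δ i)
      ≡⟨ sum-agreeExcept i (dvec-offDiag i) (cross-diag i) ⟩
    toℚ (dvec d δ i i) + sum (cross i)
      ≡⟨ cong₂ _+_ (dvec-diag i) (sum-cong-≗ (λ j → linear (s i) (c j) (s j) (c i))) ⟩
    c i + sum (λ j → s i * c j + (- c i) * s j)
      ≡⟨ cong (_+_ (c i)) (sum-linear (s i) (- c i) c s) ⟩
    c i + (s i * S + (- c i) * T)
      ∎
    where
    open ≡-Reasoning
    linear : ∀ a x b y → a * x - b * y ≡ a * x + (- y) * b
    linear = solve-∀ ℚ-ring

  σ₂-row : ∀ i → sum (λ j → toℚ (dvec d δ i j) * toℚ (dvec d δ i j))
                 ≡ c i * c i + (s i * s i * S₂ + (- (s i * c i + s i * c i)) * R + c i * c i * T₂)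
  σ₂-row i = begin
    sum (λ j → toℚ (dvec d δ i j) * toℚ (dvec d δ i j))
      ≡⟨ sum-agreeExcept i (λ j j≢i → cong (λ x → x * x) (dvec-offDiag i j j≢i)) (cong (λ x → x * x) (cross-diag i)) ⟩
    toℚ (dvec d δ i i) * toℚ (dvec d δ i i) + sum (λ j → cross i j * cross i j)
      ≡⟨ cong₂ _+_ (cong (λ x → x * x) (dvec-diag i)) (sum-cong-≗ (λ j → expand (s i) (c j) (s j) (c i))) ⟩
    c i * c i + sum (λ j → s i * s i * (c j * c j) + (- (s i * c i + s i * c i)) * (c j * s j) + c i * c i * (s j * s j))
      ≡⟨ cong (_+_ (c i * c i)) (sum-linear₃ (s i * s i) (- (s i * c i + s i * c i)) (c i * c i)
                                               (λ j → c j * c j) (λ j → c j * s j) (λ j → s j * s j)) ⟩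
    c i * c i + (s i * s i * S₂ + (- (s i * c i + s i * c i)) * R + c i * c i * T₂)
      ∎
    where
    open ≡-Reasoning
    expand : ∀ a x b y → (a * x - b * y) * (a * x - b * y) ≡ a * a * (x * x) + (- (a * y + a * y)) * (x * b) + y * y * (b * b)
    expand = solve-∀ ℚ-ring

  Q-dvec : ∀ i → toℚ (Q (dvec d δ i)) ≡ c i * c i * P (t i)
  Q-dvec i = begin
    toℚ (Q (dvec d δ i))
      ≡⟨ toℚ-Q (dvec d δ i) ⟩
    three * (sum e * sum e) - sum (λ j → e j * e j)
      ≡⟨ cong₂ (λ u v → three * (u * u) - v) (σ₁-row i) (σ₂-row i) ⟩
    F (s i)
      ≡⟨ cong F (s≡t*c i) ⟩
    F (t i * c i)
      ≡⟨ rescale three (t i) (c i) S T S₂ R T₂ ⟩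
    c i * c i * P (t i)
      ∎
    where
    open ≡-Reasoning
    e : Fin (suc n) → ℚ
    e = toℚ ∘ dvec d δ i
    F : ℚ → ℚ
    F u = three * ((c i + (u * S + (- c i) * T)) * (c i + (u * S + (- c i) * T)))
          - (c i * c i + (u * u * S₂ + (- (u * c i + u * c i)) * R + c i * c i * T₂))
    rescale : ∀ th x y S T S₂ R T₂ →
      th * ((y + (x * y * S + (- y) * T)) * (y + (x * y * S + (- y) * T)))
        - (y * y + (x * y * (x * y) * S₂ + (- (x * y * y + x * y * y)) * R + y * y * T₂))
      ≡ y * y * ((th * (S * S) - S₂) * (x * x) + (th * ((1ℚ - T) * S + (1ℚ - T) * S) + (R + R)) * x
                 + (th * ((1ℚ - T) * (1ℚ - T)) - (1ℚ + T₂)))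
    rescale = solve-∀ ℚ-ring

  Qℚ-c≢0 : Qℚ c ≢ 0ℚ
  Qℚ-c≢0 Qc≡0 = Q-pos≢0 d (ℕP.≤-trans (d>0 0F) (ℕP.m≤m+n (d 0F) _))
                          (toℚ-injective (trans (toℚ-Q (λ i → + d i)) Qc≡0))

module _ {k : ℕ} (d δ : Fin (suc (suc (suc k))) → ℕ) (d>0 : ∀ i → d i > 0) where
  open DVecProperties d δ d>0

  summand≡ : ∀ i → toℚ (+ (δ i ^ k)) * (toℚ (Q (dvec d δ i)) ÷₀ toℚ (π (dvec d δ i)))
                   ≡ ∏ c ⁻¹ * (t i ^ℚ k * P (t i) * ω′ t i ⁻¹)
  summand≡ i = begin
    toℚ (+ (δ i ^ k)) * (toℚ (Q (dvec d δ i)) ÷₀ toℚ (π (dvec d δ i)))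
      ≡⟨ cong₂ _*_ (fromℕ-^ (δ i) k) (÷₀≡*⁻¹ (toℚ (Q (dvec d δ i))) (toℚ (π (dvec d δ i)))) ⟩
    s i ^ℚ k * (toℚ (Q (dvec d δ i)) * toℚ (π (dvec d δ i)) ⁻¹)
      ≡⟨ cong₂ (λ x y → x ^ℚ k * y) (s≡t*c i) (cong₂ (λ u v → u * v ⁻¹) (Q-dvec i) (π-dvec i)) ⟩
    (t i * c i) ^ℚ k * (c i * c i * P (t i) * (c i ^ℚ 2+k * W) ⁻¹)
      ≡⟨ cong (_* (c i * c i * P (t i) * (c i ^ℚ 2+k * W) ⁻¹)) (^-distrib-* (t i) (c i) k) ⟩
    t i ^ℚ k * c i ^ℚ k * (c i * c i * P (t i) * (c i ^ℚ 2+k * W) ⁻¹)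
      ≡⟨ regroup (t i ^ℚ k) (c i ^ℚ k) (c i) (P (t i)) ((c i ^ℚ 2+k * W) ⁻¹) ⟩
    c i ^ℚ 2+k * (t i ^ℚ k * P (t i)) * (c i ^ℚ 2+k * W) ⁻¹
      ≡⟨ *-⁻¹-cancelˡ (t i ^ℚ k * P (t i)) W (^-≢0 2+k (c≢0 i)) ⟩
    t i ^ℚ k * P (t i) * W ⁻¹
      ≡⟨ cong (t i ^ℚ k * P (t i) *_) (⁻¹-distrib-* (∏ c) (ω′ t i)) ⟩
    t i ^ℚ k * P (t i) * (∏ c ⁻¹ * ω′ t i ⁻¹)
      ≡⟨ ℚ*.x∙yz≈y∙xz (t i ^ℚ k * P (t i)) (∏ c ⁻¹) (ω′ t i ⁻¹) ⟩
    ∏ c ⁻¹ * (t i ^ℚ k * P (t i) * ω′ t i ⁻¹)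
      ∎
    where
    open ≡-Reasoning
    2+k = suc (suc k)
    W = ∏ c * ω′ t i
    regroup : ∀ a b x p w → a * b * (x * x * p * w) ≡ x * (x * b) * (a * p) * w
    regroup = solve-∀ ℚ-ring

mainTheorem5 : (m : ℕ) → m ≥ 3 → (d δ : Fin m → ℕ) →
    (∀ i → d i > 0) → (∀ i → δ i > 0) →
    (∀ i → gcd (δ i) (d i) ≡ 1) →
    (∀ i j → i ≢ j → δ i ℕ.* d j ≢ δ j ℕ.* d i) →
    toℚ (π (λ i → + d i)) ÷₀ toℚ (Q (λ i → + d i))
      ℚ.* Σℚ (λ i → toℚ (+ (δ i ^ (m ∸ 3)))
                      ℚ.* (toℚ (Q (dvec d δ i)) ÷₀ toℚ (π (dvec d δ i))))
      ≡ 1ℚ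
mainTheorem5 zero                 ()
mainTheorem5 (suc zero)           (s≤s ())
mainTheorem5 (suc (suc zero))     (s≤s (s≤s ()))
mainTheorem5 (suc (suc (suc k))) _ d δ d>0 _ _ cross≢ = begin
  toℚ (π (λ i → + d i)) ÷₀ toℚ (Q (λ i → + d i)) * Σℚ summand
    ≡⟨ cong₂ _*_ (÷₀≡*⁻¹ (toℚ (π (λ i → + d i))) (toℚ (Q (λ i → + d i))))
                 (trans (Σℚ≡sum summand) (sum-cong-≗ (summand≡ d δ d>0))) ⟩
  toℚ (π (λ i → + d i)) * toℚ (Q (λ i → + d i)) ⁻¹ * sum (λ i → ∏ c ⁻¹ * (t i ^ℚ k * P (t i) * ω′ t i ⁻¹))
    ≡⟨ cong₂ (λ u v → u * v ⁻¹ * sum (λ i → ∏ c ⁻¹ * (t i ^ℚ k * P (t i) * ω′ t i ⁻¹)))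
             (toℚ-π (λ i → + d i)) (toℚ-Q (λ i → + d i)) ⟩
  ∏ c * Qℚ c ⁻¹ * sum (λ i → ∏ c ⁻¹ * (t i ^ℚ k * P (t i) * ω′ t i ⁻¹))
    ≡⟨ cong (∏ c * Qℚ c ⁻¹ *_) (sym (*-distribˡ-sum (∏ c ⁻¹) (λ i → t i ^ℚ k * P (t i) * ω′ t i ⁻¹))) ⟩
  ∏ c * Qℚ c ⁻¹ * (∏ c ⁻¹ * divDiff t (λ x → x ^ℚ k * P x))
    ≡⟨ cong (λ v → ∏ c * Qℚ c ⁻¹ * (∏ c ⁻¹ * v)) (divDiff-^-quadratic k t (t-injective cross≢) (Qℚ c) B C) ⟩
  ∏ c * Qℚ c ⁻¹ * (∏ c ⁻¹ * Qℚ c)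
    ≡⟨ ℚ*.interchange (∏ c) (Qℚ c ⁻¹) (∏ c ⁻¹) (Qℚ c) ⟩
  ∏ c * ∏ c ⁻¹ * (Qℚ c ⁻¹ * Qℚ c)
    ≡⟨ cong₂ _*_ (⁻¹-inverseʳ (∏-≢0 c c≢0)) (trans (ℚP.*-comm (Qℚ c ⁻¹) (Qℚ c)) (⁻¹-inverseʳ Qℚ-c≢0)) ⟩
  1ℚ ∎
  where
  open ≡-Reasoning
  open DVecProperties d δ d>0
  summand : Fin (suc (suc (suc k))) → ℚ
  summand i = toℚ (+ (δ i ^ k)) * (toℚ (Q (dvec d δ i)) ÷₀ toℚ (π (dvec d δ i)))
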